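{- Let $p$ be an odd prime, $g$ a primitive root mod $p$, $d\ge1$ a divisor of $p-1$, $m=(p-1)/d$, $1\le k\le d$, and $S=\{s_1<\dots<s_k\}\subseteq\{0,\dots,d-1\}$. With $z(S)$ and $\mu_t(S)$ as defined in the context, \[ \eta_S=m\,z(S)+\mu_0(S)\eta_0+\mu_1(S)\eta_1+\cdots+\mu_{d-1}(S)\eta_{d-1},\qquad z(S)+\mu_0(S)+\cdots+\mu_{d-1}(S)=m^{k-1}. \]
   Context: $C_t=\{g^{jd+t}:j=0,\dots,m-1\}$; $\zeta$ is a primitive complex $p$-th root of unity, $\eta_t=\sum_{x\in C_t}\zeta^x$, and $\eta_S=\prod_{s\in S}\eta_s$. For $\bar J=(j_2,\dots,j_k)\in(\mathbb{Z}/m\mathbb{Z})^{k-1}$ put $\theta_{\bar J}=g^{s_1}+g^{dj_2+s_2}+\cdots+g^{dj_k+s_k}\in\mathbf{F}_p$. Then $z(S)=\#\{\bar J:\theta_{\bar J}=0\}$ (equivalently the Gauss symbol $\{\{g^{s_1}\},C_{s_2},\dots,C_{s_k}\}$, the number of tuples $(x_1,\dots,x_k)\in\{g^{s_1}\}\times C_{s_2}\times\cdots\times C_{s_k}$ with sum $0$), and $\mu_t(S)=\#\{\bar J:\theta_{\bar J}\in C_t\}$ for $t=0,\dots,d-1$. -}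

module Defs where

open import Level using (Level)
open import Data.Nat using (ℕ; zero; suc; _+_; _*_; _∸_; _^_; _<_; _≤_; NonZero; _≟_)
open import Data.Nat.DivMod using (_%_)
open import Data.Nat.Primality using (Prime)
open import Data.Fin using (Fin; toℕ) renaming (zero to fzero; suc to fsuc)
open import Data.Vec using (Vec; []; _∷_; lookup)
open import Data.List using (List; []; _∷_; map; concatMap; upTo; length; filter; allFin; foldr)
open import Data.List.Membership.DecPropositional _≟_ using (_∈?_)
open import Relation.Binary.PropositionalEquality using (_≡_; _≢_)
open import Relation.Nullary using (¬_)
open import Data.Product using (_×_)
open import Algebra.Bundles using (CommutativeRing)

-- Number-theoretic side (arithmetic in F_p via residues in ℕ)

OddPrime : ℕ → Set
OddPrime p = Prime p × (p ≢ 2)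

IsPrimitiveRoot : (p : ℕ) .{{_ : NonZero p}} → ℕ → Set
IsPrimitiveRoot p g =
  (g % p ≢ 0) × (∀ j → 0 < j → j < p ∸ 1 → (g ^ j) % p ≢ 1)

C : (p : ℕ) .{{_ : NonZero p}} → (g d m t : ℕ) → List ℕ
C p g d m t = map (λ j → (g ^ (j * d + t)) % p) (upTo m)

tuples : (n m : ℕ) → List (Vec (Fin m) n)
tuples zero    m = [] ∷ []
tuples (suc n) m = concatMap (λ j → map (j ∷_) (tuples n m)) (allFin m)

theta : (p : ℕ) .{{_ : NonZero p}} → (g d m n : ℕ) →
        (Fin (suc n) → ℕ) → Vec (Fin m) n → ℕ
theta p g d m n s J =
  (g ^ s fzero + foldr _+_ 0 (map (λ i → g ^ (d * toℕ (lookup J i) + s (fsuc i))) (allFin n))) % p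

-- z(S) = #{ J̄ : θ_J̄ = 0 }   (k = suc n; k = 0 is excluded by hypothesis)
zS : (p : ℕ) .{{_ : NonZero p}} → (g d m k : ℕ) → (Fin k → ℕ) → ℕ
zS p g d m zero    s = 0
zS p g d m (suc n) s = length (filter (λ J → theta p g d m n s J ≟ 0) (tuples n m))

muS : (p : ℕ) .{{_ : NonZero p}} → (g d m k : ℕ) → (Fin k → ℕ) → ℕ → ℕ
muS p g d m zero    s t = 0
muS p g d m (suc n) s t =
  length (filter (λ J → theta p g d m n s J ∈? C p g d m t) (tuples n m))

sumℕ : ℕ → (ℕ → ℕ) → ℕ
sumℕ d f = foldr _+_ 0 (map f (upTo d))

module _ {c ℓ : Level} (R : CommutativeRing c ℓ) where
  open CommutativeRing R renaming (_+_ to _+R_; _*_ to _*R_)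

  pow : Carrier → ℕ → Carrier
  pow x zero    = 1#
  pow x (suc n) = x *R pow x n

  nat : ℕ → Carrier
  nat zero    = 0#
  nat (suc n) = 1# +R nat n

  IsPrimitiveRootOfUnity : ℕ → Carrier → Set ℓ
  IsPrimitiveRootOfUnity p ζ =
    (pow ζ p ≈ 1#) × (∀ j → 0 < j → j < p → ¬ (pow ζ j ≈ 1#))

  eta : (p : ℕ) .{{_ : NonZero p}} → (g d m : ℕ) → Carrier → ℕ → Carrier
  eta p g d m ζ t = foldr _+R_ 0# (map (pow ζ) (C p g d m t))

  etaS : (p : ℕ) .{{_ : NonZero p}} → (g d m k : ℕ) → Carrier → (Fin k → ℕ) → Carrier
  etaS p g d m k ζ s = foldr _*R_ 1# (map (λ i → eta p g d m ζ (s i)) (allFin k))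

  sumMuEta : (p : ℕ) .{{_ : NonZero p}} → (g d m k : ℕ) → Carrier → (Fin k → ℕ) → Carrier
  sumMuEta p g d m k ζ s =
    foldr _+R_ 0# (map (λ t → nat (muS p g d m k s t) *R eta p g d m ζ t) (upTo d))

module Submission where

-- Write p = q + 1 with q = d·m, Cₜ = { g^(jd+t) : j < m } and, for a residue
-- x, let orbitSum x = Σ_{j<m} ζ^(g^(jd)·x).  The proof has two halves.
-- (1) Expansion: multiplying out η_S = η_{s₁}⋯η_{s_k} and shifting the summation
--     index of every later factor by the index c of the first one (the periods
--     are invariant under this shift because g^q ≡ 1) gives
--     η_S = Σ_J orbitSum(θ_J), J ranging over (ℤ/mℤ)^(k-1).
-- (2) Classification: {0}, C₀, …, C_{d-1} partition the residues (every nonzero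
--     residue has a unique discrete logarithm below q), orbitSum 0 = m and
--     orbitSum x = ηₜ for x ∈ Cₜ.  Grouping the sum of (1) by the class of θ_J
--     gives m·z(S) + Σₜ μₜ(S)·ηₜ; grouping the constant function 1 in the same
--     way counts the tuples: z(S) + Σₜ μₜ(S) = m^(k-1).

module ListSums where

  open import Level using (Level)
  open import Data.Nat as ℕ using (ℕ; zero; suc; _<_; z≤n; s≤s)
  open import Data.Nat.Properties as ℕP using (suc-injective)
  open import Data.Fin using (Fin; toℕ) renaming (zero to fzero; suc to fsuc)
  open import Data.Vec using (Vec; _∷_; lookup)
  open import Data.List using (List; []; _∷_; map; concatMap; upTo; applyUpTo; allFin; foldr; _++_; filter; length)
  open import Data.List.Properties using (map-tabulate; map-cong)
  open import Function using (_∘_; id)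
  open import Relation.Binary.PropositionalEquality as P using (_≡_; _≢_)
  open import Relation.Nullary using (¬_; Dec; yes; no)
  open import Data.Empty using (⊥-elim)
  open import Algebra.Bundles using (CommutativeSemiring)
  open import Defs using (tuples)

  map-allFin-suc : ∀ {a} {A : Set a} n (f : Fin (suc n) → A) →
    map f (allFin (suc n)) ≡ f fzero ∷ map (f ∘ fsuc) (allFin n)
  map-allFin-suc n f =
    P.cong (f fzero ∷_) (P.trans (map-tabulate fsuc f) (P.sym (map-tabulate id (f ∘ fsuc))))

  -- Finite sums and products in a commutative semiring: over a list and over
  -- a range 0 ≤ x < n.  The list forms are exactly the folds used in Defs.
  module BigOperators {c ℓ : Level} (S : CommutativeSemiring c ℓ) where
    open CommutativeSemiring S
    open import Relation.Binary.Reasoning.Setoid setoid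

    sumL : ∀ {a} {A : Set a} → List A → (A → Carrier) → Carrier
    sumL L f = foldr _+_ 0# (map f L)

    prodL : ∀ {a} {A : Set a} → List A → (A → Carrier) → Carrier
    prodL L f = foldr _*_ 1# (map f L)

    sumR : ℕ → (ℕ → Carrier) → Carrier
    sumR zero    f = 0#
    sumR (suc n) f = f 0 + sumR n (f ∘ suc)

    𝟙 : ∀ {a} {A : Set a} → Dec A → Carrier
    𝟙 (yes _) = 1#
    𝟙 (no _)  = 0#

    𝟙-yes : ∀ {a} {A : Set a} → A → (D : Dec A) → 𝟙 D ≡ 1#
    𝟙-yes _ (yes _) = P.refl
    𝟙-yes a (no ¬a) = ⊥-elim (¬a a)

    𝟙-no : ∀ {a} {A : Set a} → ¬ A → (D : Dec A) → 𝟙 D ≡ 0#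
    𝟙-no ¬a (yes a) = ⊥-elim (¬a a)
    𝟙-no _  (no _)  = P.refl

    sumL-applyUpTo : ∀ {a} {A : Set a} n (h : ℕ → A) (f : A → Carrier) →
      sumL (applyUpTo h n) f ≡ sumR n (f ∘ h)
    sumL-applyUpTo zero    h f = P.refl
    sumL-applyUpTo (suc n) h f = P.cong (f (h 0) +_) (sumL-applyUpTo n (h ∘ suc) f)

    sumL-upTo : ∀ n f → sumL (upTo n) f ≡ sumR n f
    sumL-upTo n f = sumL-applyUpTo n id f

    sumL-allFin : ∀ n (f : ℕ → Carrier) → sumL (allFin n) (f ∘ toℕ) ≡ sumR n f
    sumL-allFin zero    f = P.refl
    sumL-allFin (suc n) f = P.trans (P.cong (foldr _+_ 0#) (map-allFin-suc n (f ∘ toℕ)))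
                                    (P.cong (f 0 +_) (sumL-allFin n (f ∘ suc)))

    sumL-map : ∀ {a b} {A : Set a} {B : Set b} (L : List A) (h : A → B) (f : B → Carrier) →
      sumL (map h L) f ≡ sumL L (f ∘ h)
    sumL-map []      h f = P.refl
    sumL-map (x ∷ L) h f = P.cong (f (h x) +_) (sumL-map L h f)

    sumL-cong : ∀ {a} {A : Set a} (L : List A) {f g : A → Carrier} →
      (∀ x → f x ≈ g x) → sumL L f ≈ sumL L g
    sumL-cong []      e = refl
    sumL-cong (x ∷ L) e = +-cong (e x) (sumL-cong L e)

    sumR-cong : ∀ n {f g : ℕ → Carrier} → (∀ x → f x ≈ g x) → sumR n f ≈ sumR n g
    sumR-cong zero    e = refl
    sumR-cong (suc n) e = +-cong (e 0) (sumR-cong n (e ∘ suc))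

    sumL-++ : ∀ {a} {A : Set a} (L M : List A) f → sumL (L ++ M) f ≈ sumL L f + sumL M f
    sumL-++ []      M f = sym (+-identityˡ _)
    sumL-++ (x ∷ L) M f = trans (+-congˡ (sumL-++ L M f)) (sym (+-assoc _ _ _))

    sumL-concatMap : ∀ {a b} {A : Set a} {B : Set b} (L : List A) (h : A → List B) f →
      sumL (concatMap h L) f ≈ sumL L (λ x → sumL (h x) f)
    sumL-concatMap []      h f = refl
    sumL-concatMap (x ∷ L) h f =
      trans (sumL-++ (h x) (concatMap h L) f) (+-congˡ (sumL-concatMap L h f))

    sumL-+ : ∀ {a} {A : Set a} (L : List A) f g →
      sumL L (λ x → f x + g x) ≈ sumL L f + sumL L g
    sumL-+ []      f g = sym (+-identityˡ _)
    sumL-+ (x ∷ L) f g = begin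
      (f x + g x) + sumL L (λ x → f x + g x) ≈⟨ +-congˡ (sumL-+ L f g) ⟩
      (f x + g x) + (sumL L f + sumL L g)    ≈⟨ +-assoc _ _ _ ⟩
      f x + (g x + (sumL L f + sumL L g))    ≈⟨ +-congˡ (x+[y+z]≈y+[x+z] _ _ _) ⟩
      f x + (sumL L f + (g x + sumL L g))    ≈⟨ sym (+-assoc _ _ _) ⟩
      (f x + sumL L f) + (g x + sumL L g)    ∎
      where
      x+[y+z]≈y+[x+z] : ∀ u v w → u + (v + w) ≈ v + (u + w)
      x+[y+z]≈y+[x+z] u v w =
        trans (sym (+-assoc u v w)) (trans (+-congʳ (+-comm u v)) (+-assoc v u w))

    sumL-*ˡ : ∀ {a} {A : Set a} (L : List A) k f → k * sumL L f ≈ sumL L (λ x → k * f x)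
    sumL-*ˡ []      k f = zeroʳ k
    sumL-*ˡ (x ∷ L) k f = trans (distribˡ _ _ _) (+-congˡ (sumL-*ˡ L k f))

    sumL-*ʳ : ∀ {a} {A : Set a} (L : List A) k f → sumL L f * k ≈ sumL L (λ x → f x * k)
    sumL-*ʳ []      k f = zeroˡ k
    sumL-*ʳ (x ∷ L) k f = trans (distribʳ _ _ _) (+-congˡ (sumL-*ʳ L k f))

    sumL-zero : ∀ {a} {A : Set a} (L : List A) → sumL L (λ _ → 0#) ≈ 0#
    sumL-zero []      = refl
    sumL-zero (x ∷ L) = trans (+-identityˡ _) (sumL-zero L)

    sumL-swap : ∀ {a b} {A : Set a} {B : Set b} (L : List A) (M : List B) (h : A → B → Carrier) →
      sumL L (λ x → sumL M (h x)) ≈ sumL M (λ y → sumL L (λ x → h x y))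
    sumL-swap []      M h = sym (sumL-zero M)
    sumL-swap (x ∷ L) M h =
      trans (+-congˡ (sumL-swap L M h)) (sym (sumL-+ M (h x) (λ y → sumL L (λ x → h x y))))

    sumR-*ʳ : ∀ n k f → sumR n f * k ≈ sumR n (λ x → f x * k)
    sumR-*ʳ zero    k f = zeroˡ k
    sumR-*ʳ (suc n) k f = trans (distribʳ _ _ _) (+-congˡ (sumR-*ʳ n k (f ∘ suc)))

    sumR-zero : ∀ n f → (∀ x → x < n → f x ≈ 0#) → sumR n f ≈ 0#
    sumR-zero zero    f e = refl
    sumR-zero (suc n) f e =
      trans (+-cong (e 0 (s≤s z≤n)) (sumR-zero n (f ∘ suc) (λ x x<n → e (suc x) (s≤s x<n))))
            (+-identityˡ _)

    sumR-single : ∀ n x₀ f → x₀ < n → (∀ x → x < n → x ≢ x₀ → f x ≈ 0#) → sumR n f ≈ f x₀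
    sumR-single (suc n) zero f _ e =
      trans (+-congˡ (sumR-zero n (f ∘ suc) (λ x x<n → e (suc x) (s≤s x<n) (λ ()))))
            (+-identityʳ _)
    sumR-single (suc n) (suc x₀) f (s≤s x₀<n) e =
      trans (+-congʳ (e 0 (s≤s z≤n) (λ ())))
        (trans (+-identityˡ _)
          (sumR-single n x₀ (f ∘ suc) x₀<n
            (λ x x<n x≢x₀ → e (suc x) (s≤s x<n) (x≢x₀ ∘ suc-injective))))

    sumR-periodic : ∀ m h → (∀ j → h (j ℕ.+ m) ≈ h j) → ∀ c →
      sumR m (λ j → h (c ℕ.+ j)) ≈ sumR m h
    sumR-periodic m h per zero    = refl
    sumR-periodic m h per (suc c) = begin
      sumR m (λ j → h (suc c ℕ.+ j))   ≈⟨ sumR-cong m (λ j → reflexive (P.cong h (P.sym (ℕP.+-suc c j)))) ⟩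
      sumR m (λ j → h (c ℕ.+ suc j))   ≈⟨ rotate m (λ j → h (c ℕ.+ j)) (trans (per c) (reflexive (P.cong h (P.sym (ℕP.+-identityʳ c))))) ⟩
      sumR m (λ j → h (c ℕ.+ j))       ≈⟨ sumR-periodic m h per c ⟩
      sumR m h                         ∎
      where
      snoc : ∀ n f → sumR (suc n) f ≈ sumR n f + f n
      snoc zero    f = trans (+-identityʳ _) (sym (+-identityˡ _))
      snoc (suc n) f = trans (+-congˡ (snoc n (f ∘ suc))) (sym (+-assoc _ _ _))
      rotate : ∀ n f → f n ≈ f 0 → sumR n (f ∘ suc) ≈ sumR n f
      rotate zero    f _ = refl
      rotate (suc n) f e = trans (snoc n (f ∘ suc)) (trans (+-congˡ e) (+-comm _ _))

    sumL-allFin-suc : ∀ n (f : Fin (suc n) → Carrier) →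
      sumL (allFin (suc n)) f ≡ f fzero + sumL (allFin n) (f ∘ fsuc)
    sumL-allFin-suc n f = P.cong (foldr _+_ 0#) (map-allFin-suc n f)

    prodL-allFin-suc : ∀ n (f : Fin (suc n) → Carrier) →
      prodL (allFin (suc n)) f ≡ f fzero * prodL (allFin n) (f ∘ fsuc)
    prodL-allFin-suc n f = P.cong (foldr _*_ 1#) (map-allFin-suc n f)

    prodL-cong : ∀ {a} {A : Set a} (L : List A) {f g : A → Carrier} →
      (∀ x → f x ≈ g x) → prodL L f ≈ prodL L g
    prodL-cong []      e = refl
    prodL-cong (x ∷ L) e = *-cong (e x) (prodL-cong L e)

    prod-of-sums : ∀ n m (F : Fin n → ℕ → Carrier) →
      prodL (allFin n) (λ i → sumR m (F i))
        ≈ sumL (tuples n m) (λ J → prodL (allFin n) (λ i → F i (toℕ (lookup J i))))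
    prod-of-sums zero    m F = sym (+-identityʳ _)
    prod-of-sums (suc n) m F = begin
      prodL (allFin (suc n)) (λ i → sumR m (F i))
        ≡⟨ prodL-allFin-suc n (λ i → sumR m (F i)) ⟩
      sumR m (F fzero) * prodL (allFin n) (λ i → sumR m (F (fsuc i)))
        ≈⟨ *-congˡ (prod-of-sums n m (F ∘ fsuc)) ⟩
      sumR m (F fzero) * sumL T rest
        ≈⟨ sumR-*ʳ m _ (F fzero) ⟩
      sumR m (λ j → F fzero j * sumL T rest)
        ≈⟨ sumR-cong m (λ j → sumL-*ˡ T (F fzero j) rest) ⟩
      sumR m (λ j → sumL T (λ J → F fzero j * rest J))
        ≡⟨ P.sym (sumL-allFin m _) ⟩
      sumL (allFin m) (λ j → sumL T (λ J → F fzero (toℕ j) * rest J))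
        ≈⟨ sumL-cong (allFin m) (λ j → sumL-cong T (λ J → reflexive (P.sym (prodL-allFin-suc n _)))) ⟩
      sumL (allFin m) (λ j → sumL T (λ J → whole (j ∷ J)))
        ≡⟨ P.sym (P.cong (foldr _+_ 0#) (map-cong (λ j → sumL-map T (j ∷_) whole) (allFin m))) ⟩
      sumL (allFin m) (λ j → sumL (map (j ∷_) T) whole)
        ≈⟨ sym (sumL-concatMap (allFin m) (λ j → map (j ∷_) T) whole) ⟩
      sumL (tuples (suc n) m) whole ∎
      where
      T : List (Vec (Fin m) n)
      T = tuples n m
      rest : Vec (Fin m) n → Carrier
      rest J = prodL (allFin n) (λ i → F (fsuc i) (toℕ (lookup J i)))
      whole : Vec (Fin m) (suc n) → Carrier
      whole J = prodL (allFin (suc n)) (λ i → F i (toℕ (lookup J i)))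

    count-as-sum : (ι : ℕ → Carrier) → ι 0 ≈ 0# → (∀ n → ι (suc n) ≈ 1# + ι n) →
      ∀ {a q} {A : Set a} {Q : A → Set q} (Q? : ∀ x → Dec (Q x)) (L : List A) →
      ι (length (filter Q? L)) ≈ sumL L (λ x → 𝟙 (Q? x))
    count-as-sum ι ι-zero ι-suc Q? [] = ι-zero
    count-as-sum ι ι-zero ι-suc Q? (x ∷ L) with Q? x
    ... | yes _ = trans (ι-suc _) (+-congˡ (count-as-sum ι ι-zero ι-suc Q? L))
    ... | no  _ = trans (count-as-sum ι ι-zero ι-suc Q? L) (sym (+-identityˡ _))

    sumL-regroup : ∀ {a} {A : Set a} (T : List A) (a₀ : Carrier) (f : A → Carrier)
      (d : ℕ) (g : ℕ → A → Carrier) (b : ℕ → Carrier) →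
      sumL T (λ J → a₀ * f J + sumR d (λ t → g t J * b t))
        ≈ a₀ * sumL T f + sumR d (λ t → sumL T (g t) * b t)
    sumL-regroup T a₀ f d g b = begin
      sumL T (λ J → a₀ * f J + sumR d (λ t → g t J * b t))
        ≈⟨ sumL-+ T _ _ ⟩
      sumL T (λ J → a₀ * f J) + sumL T (λ J → sumR d (λ t → g t J * b t))
        ≈⟨ +-cong (sym (sumL-*ˡ T a₀ f)) (sumL-cong T (λ J → reflexive (P.sym (sumL-upTo d _)))) ⟩
      a₀ * sumL T f + sumL T (λ J → sumL (upTo d) (λ t → g t J * b t))
        ≈⟨ +-congˡ (sumL-swap T (upTo d) (λ J t → g t J * b t)) ⟩
      a₀ * sumL T f + sumL (upTo d) (λ t → sumL T (λ J → g t J * b t))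
        ≈⟨ +-congˡ (reflexive (sumL-upTo d _)) ⟩
      a₀ * sumL T f + sumR d (λ t → sumL T (λ J → g t J * b t))
        ≈⟨ +-congˡ (sumR-cong d (λ t → sym (sumL-*ʳ T (b t) (g t)))) ⟩
      a₀ * sumL T f + sumR d (λ t → sumL T (g t) * b t) ∎

module NatFacts where

  open import Data.Nat using (ℕ; zero; suc; _+_; _*_; _∸_; _^_; _≤_; NonZero)
  open import Data.Nat.Properties
  open import Data.Nat.DivMod
  open import Data.Nat.Divisibility using (_∣_; divides)
  open import Data.Nat.Tactic.RingSolver using (solve-∀)
  open import Data.Fin using (Fin)
  open import Data.Vec using (_∷_)
  open import Data.List using (map; allFin)
  open import Relation.Binary.PropositionalEquality
  open import Defs using (tuples)
  open ListSums

  shift-exponent : ∀ j m d t → (j + m) * d + t ≡ (j * d + t) + m * d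
  shift-exponent = solve-∀

  add-exponent : ∀ j j′ d t → j * d + (j′ * d + t) ≡ (j′ + j) * d + t
  add-exponent = solve-∀

  split-exponent : ∀ c x d t → (c + x) * d + t ≡ c * d + (d * x + t)
  split-exponent = solve-∀

  [m*n]%d≡[m*[n%d]]%d : ∀ m n d .{{_ : NonZero d}} → (m * n) % d ≡ (m * (n % d)) % d
  [m*n]%d≡[m*[n%d]]%d m n d = trans (%-distribˡ-* m n d)
    (trans (cong (λ r → (m % d * r) % d) (sym (m%n%n≡m%n n d))) (sym (%-distribˡ-* m (n % d) d)))

  %-≡⇒∣∸ : ∀ a b d .{{_ : NonZero d}} → a % d ≡ b % d → a ≤ b → d ∣ b ∸ a
  %-≡⇒∣∸ a b d eq _ = divides (b / d ∸ a / d) (begin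
    b ∸ a                                       ≡⟨ cong₂ _∸_ (m≡m%n+[m/n]*n b d) (m≡m%n+[m/n]*n a d) ⟩
    (b % d + b / d * d) ∸ (a % d + a / d * d)   ≡⟨ cong (λ r → (r + b / d * d) ∸ (a % d + a / d * d)) (sym eq) ⟩
    (a % d + b / d * d) ∸ (a % d + a / d * d)   ≡⟨ [m+n]∸[m+o]≡n∸o (a % d) _ _ ⟩
    b / d * d ∸ a / d * d                       ≡⟨ sym (*-distribʳ-∸ d (b / d) (a / d)) ⟩
    (b / d ∸ a / d) * d                         ∎)
    where open ≡-Reasoning

  module ℕΣ = BigOperators +-*-commutativeSemiring

  factor-g^ : ∀ g d c s₀ n (x t : Fin n → ℕ) →
    g ^ (c * d + s₀) + ℕΣ.sumL (allFin n) (λ i → g ^ ((c + x i) * d + t i))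
      ≡ g ^ (c * d) * (g ^ s₀ + ℕΣ.sumL (allFin n) (λ i → g ^ (d * x i + t i)))
  factor-g^ g d c s₀ n x t = begin
    g ^ (c * d + s₀) + ℕΣ.sumL (allFin n) (λ i → g ^ ((c + x i) * d + t i))
      ≡⟨ cong₂ _+_ (^-distribˡ-+-* g (c * d) s₀)
           (ℕΣ.sumL-cong (allFin n) (λ i → trans (cong (g ^_) (split-exponent c (x i) d (t i)))
                                                    (^-distribˡ-+-* g (c * d) (d * x i + t i)))) ⟩
    g ^ (c * d) * g ^ s₀ + ℕΣ.sumL (allFin n) (λ i → g ^ (c * d) * g ^ (d * x i + t i))
      ≡⟨ cong (g ^ (c * d) * g ^ s₀ +_) (sym (ℕΣ.sumL-*ˡ (allFin n) (g ^ (c * d)) _)) ⟩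
    g ^ (c * d) * g ^ s₀ + g ^ (c * d) * ℕΣ.sumL (allFin n) (λ i → g ^ (d * x i + t i))
      ≡⟨ sym (*-distribˡ-+ (g ^ (c * d)) _ _) ⟩
    g ^ (c * d) * (g ^ s₀ + ℕΣ.sumL (allFin n) (λ i → g ^ (d * x i + t i))) ∎
    where open ≡-Reasoning

  tuples-count : ∀ n m → ℕΣ.sumL (tuples n m) (λ _ → 1) ≡ m ^ n
  tuples-count zero    m = refl
  tuples-count (suc n) m = begin
    ℕΣ.sumL (tuples (suc n) m) (λ _ → 1)
      ≡⟨ ℕΣ.sumL-concatMap (allFin m) (λ j → map (j ∷_) (tuples n m)) (λ _ → 1) ⟩
    ℕΣ.sumL (allFin m) (λ j → ℕΣ.sumL (map (j ∷_) (tuples n m)) (λ _ → 1))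
      ≡⟨ ℕΣ.sumL-cong (allFin m) (λ j → trans (ℕΣ.sumL-map (tuples n m) (j ∷_) (λ _ → 1)) (tuples-count n m)) ⟩
    ℕΣ.sumL (allFin m) (λ _ → m ^ n)
      ≡⟨ ℕΣ.sumL-allFin m (λ _ → m ^ n) ⟩
    ℕΣ.sumR m (λ _ → m ^ n)
      ≡⟨ constant m ⟩
    m * m ^ n ∎
    where
    open ≡-Reasoning
    constant : ∀ k → ℕΣ.sumR k (λ _ → m ^ n) ≡ k * m ^ n
    constant zero    = refl
    constant (suc k) = cong (m ^ n +_) (constant k)

module Residues where

  open import Data.Nat using (ℕ; zero; suc; _+_; _*_; _∸_; _^_; _<_; _≤_; _<?_; s≤s; s≤s⁻¹; nonTrivial⇒n>1)
  open import Data.Nat.Properties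
  open import Data.Nat.DivMod
  open import Data.Nat.Divisibility using (_∣_; ∣1⇒≡1; n∣m⇒m%n≡0; m%n≡0⇒n∣m)
  open import Data.Nat.Primality using (Prime; euclidsLemma; prime⇒nonTrivial)
  open import Data.Fin using (Fin; toℕ; fromℕ<) renaming (_<_ to _<ᶠ_)
  open import Data.Fin.Properties using (pigeonhole; toℕ<n; toℕ-fromℕ<)
  open import Data.Product using (_×_; _,_; ∃; proj₁; proj₂)
  open import Data.Sum using (_⊎_; inj₁; inj₂)
  open import Relation.Binary.PropositionalEquality
  open import Relation.Nullary using (¬_; Dec; yes; no)
  open import Relation.Nullary.Negation using (contradiction)
  open import Data.Empty using (⊥-elim)
  open import Function using (_∘_)
  open NatFacts

  module PrimitiveRoot (q g : ℕ) (p-prime : Prime (suc q))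
      (g≢0 : g % suc q ≢ 0) (order : ∀ j → 0 < j → j < q → (g ^ j) % suc q ≢ 1) where

    p : ℕ
    p = suc q

    q≥1 : 1 ≤ q
    q≥1 = s≤s⁻¹ (nonTrivial⇒n>1 p {{prime⇒nonTrivial p-prime}})

    1%p≡1 : 1 % p ≡ 1
    1%p≡1 = m<n⇒m%n≡m (s≤s q≥1)

    p∤g^ : ∀ e → ¬ p ∣ g ^ e
    p∤g^ zero    p∣1 = contradiction (subst (1 ≤_) (suc-injective (∣1⇒≡1 p∣1)) q≥1) λ ()
    p∤g^ (suc e) p∣g^1+e with euclidsLemma g (g ^ e) p-prime p∣g^1+e
    ... | inj₁ p∣g   = g≢0 (n∣m⇒m%n≡0 g p p∣g)
    ... | inj₂ p∣g^e = p∤g^ e p∣g^e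

    g^%p>0 : ∀ e → 0 < (g ^ e) % p
    g^%p>0 e = n≢0⇒n>0 (p∤g^ e ∘ m%n≡0⇒n∣m (g ^ e) p)

    cancel-≤ : ∀ x u v → ¬ p ∣ x → u ≤ v → (x * u) % p ≡ (x * v) % p → u % p ≡ v % p
    cancel-≤ x u v p∤x u≤v eq =
      sym (trans (cong (_% p) (sym (m+[n∸m]≡n u≤v))) (%-remove-+ʳ u p∣v∸u))
      where
      p∣x*[v∸u] : p ∣ x * (v ∸ u)
      p∣x*[v∸u] = subst (p ∣_) (sym (*-distribˡ-∸ x v u))
                    (%-≡⇒∣∸ (x * u) (x * v) p eq (*-monoʳ-≤ x u≤v))
      p∣v∸u : p ∣ v ∸ u
      p∣v∸u with euclidsLemma x (v ∸ u) p-prime p∣x*[v∸u]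
      ... | inj₁ p∣x   = contradiction p∣x p∤x
      ... | inj₂ p∣v∸u = p∣v∸u

    cancel : ∀ x u v → ¬ p ∣ x → (x * u) % p ≡ (x * v) % p → u % p ≡ v % p
    cancel x u v p∤x eq with ≤-total u v
    ... | inj₁ u≤v = cancel-≤ x u v p∤x u≤v eq
    ... | inj₂ v≤u = sym (cancel-≤ x v u p∤x v≤u (sym eq))

    powers-coincide : ∀ i j → i < j → j ≤ q → (g ^ i) % p ≡ (g ^ j) % p → i ≡ 0 × j ≡ q
    powers-coincide i j i<j j≤q g^i≡g^j = i≡0 , j≡q
      where
      r : ℕ
      r = j ∸ i
      i+r≡j : i + r ≡ j
      i+r≡j = m+[n∸m]≡n (<⇒≤ i<j)
      g^r≡1 : (g ^ r) % p ≡ 1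
      g^r≡1 = trans (sym (cancel (g ^ i) 1 (g ^ r) (p∤g^ i) g^i·1≡g^i·g^r)) 1%p≡1
        where
        g^i·1≡g^i·g^r : (g ^ i * 1) % p ≡ (g ^ i * g ^ r) % p
        g^i·1≡g^i·g^r = trans (cong (_% p) (*-identityʳ (g ^ i)))
          (trans g^i≡g^j (cong (_% p) (trans (cong (g ^_) (sym i+r≡j)) (^-distribˡ-+-* g i r))))
      q≤r : q ≤ r
      q≤r with r <? q
      ... | yes r<q = contradiction g^r≡1 (order r (m<n⇒0<n∸m i<j) r<q)
      ... | no  r≮q = ≮⇒≥ r≮q
      j≡q : j ≡ q
      j≡q = ≤-antisym j≤q (≤-trans q≤r (m∸n≤m j i))
      i≡0 : i ≡ 0
      i≡0 = +-cancelʳ-≡ j i 0 (trans (cong (i +_) (≤-antisym (≤-trans j≤q q≤r) (m∸n≤m j i))) i+r≡j)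

    -- Every nonzero residue x is a power of g: by pigeonhole, the p values
    -- g^0, …, g^(q-1), x in {1, …, q} must contain a repetition, and by
    -- powers-coincide it can only involve x.
    discrete-log : ∀ x → 0 < x → x < p → ∃ λ e → e < q × (g ^ e) % p ≡ x
    discrete-log x 0<x x<p = repetition (pigeonhole (n<1+n q) slot)
      where
      choose : ∀ {n} → Dec (n < q) → ℕ
      choose {n} (yes _) = (g ^ n) % p
      choose     (no _)  = x
      h : ℕ → ℕ
      h n = choose (n <? q)
      Value : ℕ → Set
      Value n = (n < q × h n ≡ (g ^ n) % p) ⊎ (q ≤ n × h n ≡ x)
      value : ∀ n → Value n
      value n with n <? q
      ... | yes n<q = inj₁ (n<q , refl)
      ... | no  n≮q = inj₂ (≮⇒≥ n≮q , refl)
      h-range : ∀ n → 0 < h n × h n < p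
      h-range n with value n
      ... | inj₁ (_ , hn≡) = subst (0 <_) (sym hn≡) (g^%p>0 n) , subst (_< p) (sym hn≡) (m%n<n (g ^ n) p)
      ... | inj₂ (_ , hn≡) = subst (0 <_) (sym hn≡) 0<x , subst (_< p) (sym hn≡) x<p
      h∸1<q : ∀ n → h n ∸ 1 < q
      h∸1<q n = ∸-monoˡ-< (proj₂ (h-range n)) (proj₁ (h-range n))
      slot : Fin p → Fin q
      slot n = fromℕ< (h∸1<q (toℕ n))
      slot-injective : ∀ i j → slot i ≡ slot j → h (toℕ i) ≡ h (toℕ j)
      slot-injective i j same = ∸-cancelʳ-≡ (proj₁ (h-range (toℕ i))) (proj₁ (h-range (toℕ j)))
        (trans (sym (toℕ-fromℕ< (h∸1<q (toℕ i)))) (trans (cong toℕ same) (toℕ-fromℕ< (h∸1<q (toℕ j)))))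
      repetition : (∃ λ i → ∃ λ j → i <ᶠ j × slot i ≡ slot j) → ∃ λ e → e < q × (g ^ e) % p ≡ x
      repetition (i , j , i<j , same) = from (value (toℕ i)) (value (toℕ j))
        where
        hi≡hj : h (toℕ i) ≡ h (toℕ j)
        hi≡hj = slot-injective i j same
        j≤q : toℕ j ≤ q
        j≤q = ≤-pred (toℕ<n j)
        from : Value (toℕ i) → Value (toℕ j) → ∃ λ e → e < q × (g ^ e) % p ≡ x
        from (inj₁ (i<q , hi≡)) (inj₁ (j<q , hj≡)) =
          ⊥-elim (<-irrefl (proj₂ (powers-coincide (toℕ i) (toℕ j) i<j j≤q (trans (sym hi≡) (trans hi≡hj hj≡)))) j<q)
        from (inj₁ (i<q , hi≡)) (inj₂ (_ , hj≡)) = toℕ i , i<q , trans (sym hi≡) (trans hi≡hj hj≡)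
        from (inj₂ (q≤i , _)) _ = ⊥-elim (<-irrefl refl (≤-<-trans q≤i (<-≤-trans i<j j≤q)))

    -- Fermat: g^q ≡ g^e for some e < q, and powers-coincide forces e = 0
    fermat : (g ^ q) % p ≡ 1
    fermat with discrete-log ((g ^ q) % p) (g^%p>0 q) (m%n<n (g ^ q) p)
    ... | e , e<q , g^e≡g^q with powers-coincide e q e<q ≤-refl g^e≡g^q
    ... | refl , _ = trans (sym g^e≡g^q) 1%p≡1

    g^-periodic : ∀ x → (g ^ (x + q)) % p ≡ (g ^ x) % p
    g^-periodic x = begin
      (g ^ (x + q)) % p        ≡⟨ cong (_% p) (^-distribˡ-+-* g x q) ⟩
      (g ^ x * g ^ q) % p      ≡⟨ [m*n]%d≡[m*[n%d]]%d (g ^ x) (g ^ q) p ⟩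
      (g ^ x * (g ^ q % p)) % p ≡⟨ cong (λ r → (g ^ x * r) % p) fermat ⟩
      (g ^ x * 1) % p          ≡⟨ cong (_% p) (*-identityʳ (g ^ x)) ⟩
      (g ^ x) % p              ∎
      where open ≡-Reasoning

module Partitions where

  open import Level using (Level)
  open import Data.Nat using (ℕ; suc; _<_; _≟_)
  open import Data.List using (List; filter; length)
  open import Data.List.Membership.DecPropositional _≟_ using (_∈_; _∈?_)
  open import Data.Product using (_×_; _,_; ∃)
  open import Relation.Binary.PropositionalEquality as P using (_≡_; _≢_)
  open import Relation.Nullary using (¬_; yes; no)
  open import Function using (_∘_)
  open import Algebra.Bundles using (CommutativeSemiring)
  open ListSums

  module PartitionSums {c ℓ : Level} (S : CommutativeSemiring c ℓ) (p d : ℕ) (class : ℕ → List ℕ)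
    (0∉class : ∀ t → ¬ (0 ∈ class t))
    (class-unique : ∀ {x t t′} → t < d → t′ < d → x ∈ class t → x ∈ class t′ → t ≡ t′)
    (class-exists : ∀ x → x < p → x ≢ 0 → ∃ λ t → t < d × x ∈ class t) where
    open CommutativeSemiring S
    open BigOperators S
    open import Relation.Binary.Reasoning.Setoid setoid

    class-function : (w : ℕ → Carrier) (a : Carrier) (b : ℕ → Carrier) →
      w 0 ≈ a → (∀ {x t} → t < d → x ∈ class t → w x ≈ b t) →
      ∀ x → x < p → w x ≈ a * 𝟙 (x ≟ 0) + sumR d (λ t → 𝟙 (x ∈? class t) * b t)
    class-function w a b w0≈a wₜ≈bₜ x x<p with x ≟ 0
    ... | yes P.refl = begin
      w 0         ≈⟨ w0≈a ⟩
      a           ≈⟨ sym (*-identityʳ a) ⟩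
      a * 1#      ≈⟨ sym (+-identityʳ _) ⟩
      a * 1# + 0# ≈⟨ +-congˡ (sym (sumR-zero d _ (λ t _ →
                      trans (*-congʳ (reflexive (𝟙-no (0∉class t) (0 ∈? class t)))) (zeroˡ (b t))))) ⟩
      a * 1# + sumR d (λ t → 𝟙 (0 ∈? class t) * b t) ∎
    ... | no x≢0 with class-exists x x<p x≢0
    ...   | t₀ , t₀<d , x∈Cₜ₀ = begin
      w x           ≈⟨ wₜ≈bₜ t₀<d x∈Cₜ₀ ⟩
      b t₀          ≈⟨ sym (trans (*-congʳ (reflexive (𝟙-yes x∈Cₜ₀ (x ∈? class t₀)))) (*-identityˡ (b t₀))) ⟩
      𝟙 (x ∈? class t₀) * b t₀
        ≈⟨ sym (sumR-single d t₀ _ t₀<d (λ t t<d t≢t₀ →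
             trans (*-congʳ (reflexive (𝟙-no (t≢t₀ ∘ (λ x∈Cₜ → class-unique t<d t₀<d x∈Cₜ x∈Cₜ₀)) (x ∈? class t))))
                   (zeroˡ (b t)))) ⟩
      sumR d (λ t → 𝟙 (x ∈? class t) * b t)          ≈⟨ sym (+-identityˡ _) ⟩
      0# + sumR d (λ t → 𝟙 (x ∈? class t) * b t)     ≈⟨ +-congʳ (sym (zeroʳ a)) ⟩
      a * 0# + sumR d (λ t → 𝟙 (x ∈? class t) * b t) ∎

    sum-by-classes : (ι : ℕ → Carrier) → ι 0 ≈ 0# → (∀ n → ι (suc n) ≈ 1# + ι n) →
      (w : ℕ → Carrier) (a : Carrier) (b : ℕ → Carrier) →
      w 0 ≈ a → (∀ {x t} → t < d → x ∈ class t → w x ≈ b t) →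
      ∀ {i} {A : Set i} (θ : A → ℕ) → (∀ J → θ J < p) → (T : List A) →
      sumL T (w ∘ θ) ≈ a * ι (length (filter (λ J → θ J ≟ 0) T))
                       + sumR d (λ t → ι (length (filter (λ J → θ J ∈? class t) T)) * b t)
    sum-by-classes ι ι-zero ι-suc w a b w0≈a wₜ≈bₜ θ θ<p T = begin
      sumL T (w ∘ θ)
        ≈⟨ sumL-cong T (λ J → class-function w a b w0≈a wₜ≈bₜ (θ J) (θ<p J)) ⟩
      sumL T (λ J → a * 𝟙 (θ J ≟ 0) + sumR d (λ t → 𝟙 (θ J ∈? class t) * b t))
        ≈⟨ sumL-regroup T a (λ J → 𝟙 (θ J ≟ 0)) d (λ t J → 𝟙 (θ J ∈? class t)) b ⟩
      a * sumL T (λ J → 𝟙 (θ J ≟ 0)) + sumR d (λ t → sumL T (λ J → 𝟙 (θ J ∈? class t)) * b t)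
        ≈⟨ sym (+-cong (*-congˡ (count-as-sum ι ι-zero ι-suc (λ J → θ J ≟ 0) T))
                       (sumR-cong d (λ t → *-congʳ (count-as-sum ι ι-zero ι-suc (λ J → θ J ∈? class t) T)))) ⟩
      a * ι (length (filter (λ J → θ J ≟ 0) T))
        + sumR d (λ t → ι (length (filter (λ J → θ J ∈? class t) T)) * b t) ∎

module Cyclotomic where

  open import Data.Nat using (ℕ; suc; _+_; _*_; _^_; _<_; _≤_; _≟_; NonZero; >-nonZero)
  open import Data.Nat.Properties
  open import Data.Nat.DivMod
  open import Data.Nat.Primality using (Prime)
  open import Data.Fin using (Fin; toℕ) renaming (zero to fzero; suc to fsuc)
  open import Data.Vec using (Vec; lookup)
  open import Data.List using (List; map; foldr; allFin)
  open import Data.List.Membership.DecPropositional _≟_ using (_∈_)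
  open import Data.List.Relation.Unary.Any.Properties using (map⁺; map⁻; applyUpTo⁺; applyUpTo⁻)
  open import Data.Product using (_×_; _,_; ∃; proj₂)
  open import Relation.Binary.PropositionalEquality as P using (_≡_; _≢_)
  open import Relation.Binary using (tri<; tri≈; tri>)
  open import Relation.Nullary using (¬_)
  open import Data.Empty using (⊥-elim)
  open import Function using (id)
  open import Defs using (C; theta; tuples; zS; muS; sumℕ)
  open ListSums
  open NatFacts
  open Residues
  open Partitions

  module CyclotomicClasses (q g d m : ℕ) (p-prime : Prime (suc q))
      (g≢0 : g % suc q ≢ 0) (order : ∀ j → 0 < j → j < q → (g ^ j) % suc q ≢ 1)
      (d≥1 : 1 ≤ d) (d*m≡q : d * m ≡ q) where

    open PrimitiveRoot q g p-prime g≢0 order public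

    instance
      d≢0 : NonZero d
      d≢0 = >-nonZero d≥1

    class : ℕ → List ℕ
    class t = C p g d m t

    ∈class⇒power : ∀ {x t} → x ∈ class t → ∃ λ j → j < m × x ≡ (g ^ (j * d + t)) % p
    ∈class⇒power x∈Cₜ = applyUpTo⁻ id (map⁻ x∈Cₜ)

    power∈class : ∀ {j} t → j < m → (g ^ (j * d + t)) % p ∈ class t
    power∈class t j<m = map⁺ (applyUpTo⁺ id P.refl j<m)

    0∉class : ∀ t → ¬ (0 ∈ class t)
    0∉class t 0∈Cₜ with ∈class⇒power 0∈Cₜ
    ... | j , _ , 0≡g^ = <-irrefl 0≡g^ (g^%p>0 (j * d + t))

    exponent<q : ∀ {j t} → j < m → t < d → j * d + t < q
    exponent<q {j} {t} j<m t<d = begin-strict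
      j * d + t  <⟨ +-monoʳ-< (j * d) t<d ⟩
      j * d + d  ≡⟨ +-comm (j * d) d ⟩
      suc j * d  ≤⟨ *-monoˡ-≤ d j<m ⟩
      m * d      ≡⟨ P.trans (*-comm m d) d*m≡q ⟩
      q          ∎
      where open ≤-Reasoning

    exponent%d : ∀ j t → t < d → (j * d + t) % d ≡ t
    exponent%d j t t<d = P.trans (P.cong (_% d) (+-comm (j * d) t))
      (P.trans ([m+kn]%n≡m%n t j d) (m<n⇒m%n≡m t<d))

    -- the classes are disjoint: distinct exponents below q give distinct powers
    class-unique : ∀ {x t t′} → t < d → t′ < d → x ∈ class t → x ∈ class t′ → t ≡ t′
    class-unique {x} {t} {t′} t<d t′<d x∈Cₜ x∈Cₜ′
      with ∈class⇒power x∈Cₜ | ∈class⇒power x∈Cₜ′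
    ... | j , j<m , x≡ | j′ , j′<m , x≡′ =
      P.trans (P.sym (exponent%d j t t<d)) (P.trans (P.cong (_% d) e≡e′) (exponent%d j′ t′ t′<d))
      where
      e e′ : ℕ
      e  = j * d + t
      e′ = j′ * d + t′
      g^e≡g^e′ : (g ^ e) % p ≡ (g ^ e′) % p
      g^e≡g^e′ = P.trans (P.sym x≡) x≡′
      e≡e′ : e ≡ e′
      e≡e′ with <-cmp e e′
      ... | tri< e<e′ _ _ = ⊥-elim (<-irrefl (proj₂ (powers-coincide e e′ e<e′ (<⇒≤ (exponent<q j′<m t′<d)) g^e≡g^e′)) (exponent<q j′<m t′<d))
      ... | tri≈ _ e≡e′ _ = e≡e′
      ... | tri> _ _ e′<e = ⊥-elim (<-irrefl (proj₂ (powers-coincide e′ e e′<e (<⇒≤ (exponent<q j<m t<d)) (P.sym g^e≡g^e′))) (exponent<q j<m t<d))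

    -- every nonzero residue lies in some class: write its discrete log as j·d + t
    class-exists : ∀ x → x < p → x ≢ 0 → ∃ λ t → t < d × x ∈ class t
    class-exists x x<p x≢0 with discrete-log x (n≢0⇒n>0 x≢0) x<p
    ... | e , e<q , g^e≡x = e % d , m%n<n e d ,
        P.subst (_∈ class (e % d)) (P.trans (P.cong (λ r → (g ^ r) % p) (P.sym e≡)) g^e≡x)
                (power∈class (e % d) (m<n*o⇒m/o<n (P.subst (e <_) (P.trans (P.sym d*m≡q) (*-comm d m)) e<q)))
      where
      e≡ : e ≡ (e / d) * d + e % d
      e≡ = P.trans (m≡m%n+[m/n]*n e d) (+-comm (e % d) _)

    theta<p : ∀ n (s : Fin (suc n) → ℕ) (J : Vec (Fin m) n) → theta p g d m n s J < p
    theta<p n s J = m%n<n (g ^ s fzero + foldr _+_ 0 (map (λ i → g ^ (d * toℕ (lookup J i) + s (fsuc i))) (allFin n))) p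

    -- Every θ_J lies in exactly one of {0}, C₀, …, C_{d-1}, so counting the
    -- mⁿ tuples J by class gives z(S) + Σₜ μₜ(S) = mⁿ.
    class-counts : ∀ n (s : Fin (suc n) → ℕ) →
      zS p g d m (suc n) s + sumℕ d (muS p g d m (suc n) s) ≡ m ^ n
    class-counts n s = begin
      z + sumℕ d μ                       ≡⟨ P.cong₂ _+_ (P.sym (*-identityˡ z)) μ-sum ⟩
      1 * z + ℕΣ.sumR d (λ t → μ t * 1)  ≡⟨ P.sym (ByClass.sum-by-classes (λ x → x) P.refl (λ _ → P.refl)
                                              (λ _ → 1) 1 (λ _ → 1) P.refl (λ _ _ → P.refl) (theta p g d m n s) (theta<p n s) (tuples n m)) ⟩
      ℕΣ.sumL (tuples n m) (λ _ → 1)     ≡⟨ tuples-count n m ⟩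
      m ^ n                              ∎
      where
      open P.≡-Reasoning
      module ByClass = PartitionSums +-*-commutativeSemiring p d class 0∉class class-unique class-exists
      z : ℕ
      z = zS p g d m (suc n) s
      μ : ℕ → ℕ
      μ = muS p g d m (suc n) s
      μ-sum : sumℕ d μ ≡ ℕΣ.sumR d (λ t → μ t * 1)
      μ-sum = P.trans (ℕΣ.sumL-upTo d μ) (ℕΣ.sumR-cong d (λ t → P.sym (*-identityʳ (μ t))))

module Periods where

  open import Level using (Level)
  open import Data.Nat using (ℕ; zero; suc; _+_; _*_; _^_; _<_; _≤_; _≟_)
  open import Data.Nat.Properties as ℕP using ()
  open import Data.Nat.DivMod using (_%_; _/_; m≡m%n+[m/n]*n)
  open import Data.Nat.Primality using (Prime)
  open import Data.Fin using (Fin; toℕ) renaming (zero to fzero; suc to fsuc)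
  open import Data.Vec using (Vec; lookup)
  open import Data.List using (List; map; upTo; allFin)
  open import Data.List.Membership.DecPropositional _≟_ using (_∈_)
  open import Data.Product using (_,_)
  open import Relation.Binary.PropositionalEquality as P using (_≡_; _≢_)
  open import Function using (_∘_)
  open import Algebra.Bundles using (CommutativeRing)
  open import Defs using (pow; nat; eta; etaS; theta; tuples; zS; muS; sumMuEta)
  open ListSums
  open NatFacts
  open Partitions
  open Cyclotomic

  module CanonicalMap {c ℓ : Level} (R : CommutativeRing c ℓ) where
    open CommutativeRing R renaming (_+_ to _+R_; _*_ to _*R_)

    nat-+ : ∀ a b → nat R (a + b) ≈ nat R a +R nat R b
    nat-+ zero    b = sym (+-identityˡ _)
    nat-+ (suc a) b = trans (+-congˡ (nat-+ a b)) (sym (+-assoc _ _ _))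

    nat-* : ∀ a b → nat R (a * b) ≈ nat R a *R nat R b
    nat-* zero    b = sym (zeroˡ _)
    nat-* (suc a) b = trans (nat-+ b (a * b))
      (trans (+-cong (sym (*-identityˡ _)) (nat-* a b)) (sym (distribʳ _ _ _)))

  module GaussPeriods {c ℓ : Level} (R : CommutativeRing c ℓ) (ζ : CommutativeRing.Carrier R)
      (q g d m : ℕ) (p-prime : Prime (suc q))
      (g≢0 : g % suc q ≢ 0) (order : ∀ j → 0 < j → j < q → (g ^ j) % suc q ≢ 1)
      (d≥1 : 1 ≤ d) (d*m≡q : d * m ≡ q)
      (ζ^p≈1 : CommutativeRing._≈_ R (pow R ζ (suc q)) (CommutativeRing.1# R)) where

    open CommutativeRing R renaming (_+_ to _+R_; _*_ to _*R_)
    open CyclotomicClasses q g d m p-prime g≢0 order d≥1 d*m≡q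
    open CanonicalMap R
    open BigOperators commutativeSemiring
    open import Relation.Binary.Reasoning.Setoid setoid

    ζ^ : ℕ → Carrier
    ζ^ = pow R ζ

    ζ^-+ : ∀ a b → ζ^ (a + b) ≈ ζ^ a *R ζ^ b
    ζ^-+ zero    b = sym (*-identityˡ _)
    ζ^-+ (suc a) b = trans (*-congˡ (ζ^-+ a b)) (sym (*-assoc _ _ _))

    ζ^-multiple : ∀ k → ζ^ (k * p) ≈ 1#
    ζ^-multiple zero    = refl
    ζ^-multiple (suc k) = trans (ζ^-+ p (k * p)) (trans (*-cong ζ^p≈1 (ζ^-multiple k)) (*-identityˡ _))

    ζ^-mod : ∀ x → ζ^ x ≈ ζ^ (x % p)
    ζ^-mod x = begin
      ζ^ x                          ≡⟨ P.cong ζ^ (m≡m%n+[m/n]*n x p) ⟩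
      ζ^ (x % p + x / p * p)        ≈⟨ ζ^-+ (x % p) (x / p * p) ⟩
      ζ^ (x % p) *R ζ^ (x / p * p)  ≈⟨ *-congˡ (ζ^-multiple (x / p)) ⟩
      ζ^ (x % p) *R 1#              ≈⟨ *-identityʳ _ ⟩
      ζ^ (x % p)                    ∎

    ζ^-cong : ∀ a b → a % p ≡ b % p → ζ^ a ≈ ζ^ b
    ζ^-cong a b a≡b = trans (ζ^-mod a) (trans (reflexive (P.cong ζ^ a≡b)) (sym (ζ^-mod b)))

    η : ℕ → Carrier
    η t = eta R p g d m ζ t

    η-shifted : ∀ t c → η t ≈ sumR m (λ j → ζ^ (g ^ ((c + j) * d + t)))
    η-shifted t c = begin
      sumL (map (λ j → (g ^ (j * d + t)) % p) (upTo m)) ζ^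
        ≡⟨ sumL-map (upTo m) _ ζ^ ⟩
      sumL (upTo m) (λ j → ζ^ ((g ^ (j * d + t)) % p))
        ≡⟨ sumL-upTo m _ ⟩
      sumR m (λ j → ζ^ ((g ^ (j * d + t)) % p))
        ≈⟨ sumR-cong m (λ j → sym (ζ^-mod (g ^ (j * d + t)))) ⟩
      sumR m (λ j → ζ^ (g ^ (j * d + t)))
        ≈⟨ sym (sumR-periodic m (λ j → ζ^ (g ^ (j * d + t))) period c) ⟩
      sumR m (λ j → ζ^ (g ^ ((c + j) * d + t))) ∎
      where
      period : ∀ j → ζ^ (g ^ ((j + m) * d + t)) ≈ ζ^ (g ^ (j * d + t))
      period j = ζ^-cong (g ^ ((j + m) * d + t)) (g ^ (j * d + t)) (P.trans (P.cong (λ e → (g ^ e) % p) shift) (g^-periodic (j * d + t)))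
        where
        shift : (j + m) * d + t ≡ (j * d + t) + q
        shift = P.trans (shift-exponent j m d t) (P.cong ((j * d + t) +_) (P.trans (ℕP.*-comm m d) d*m≡q))

    orbitSum : ℕ → Carrier
    orbitSum x = sumR m (λ j → ζ^ (g ^ (j * d) * x))

    orbitSum-0 : orbitSum 0 ≈ nat R m
    orbitSum-0 = trans (sumR-cong m (λ j → reflexive (P.cong ζ^ (ℕP.*-zeroʳ (g ^ (j * d))))))
                       (ones m)
      where
      ones : ∀ k → sumR k (λ _ → 1#) ≈ nat R k
      ones zero    = refl
      ones (suc k) = +-congˡ (ones k)

    -- multiplying by C₀ permutes the class Cₜ, so the orbit sum of x ∈ Cₜ is ηₜ
    orbitSum-class : ∀ {x t} → x ∈ class t → orbitSum x ≈ η t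
    orbitSum-class {x} {t} x∈Cₜ with ∈class⇒power x∈Cₜ
    ... | j′ , _ , x≡ = begin
      orbitSum x                                    ≈⟨ sumR-cong m (λ j → ζ^-cong (g ^ (j * d) * x) (g ^ ((j′ + j) * d + t)) (residue j)) ⟩
      sumR m (λ j → ζ^ (g ^ ((j′ + j) * d + t)))    ≈⟨ sym (η-shifted t j′) ⟩
      η t                                           ∎
      where
      residue : ∀ j → (g ^ (j * d) * x) % p ≡ (g ^ ((j′ + j) * d + t)) % p
      residue j = P.trans (P.cong (λ r → (g ^ (j * d) * r) % p) x≡)
        (P.trans (P.sym ([m*n]%d≡[m*[n%d]]%d (g ^ (j * d)) (g ^ (j′ * d + t)) p))
          (P.cong (_% p) (P.trans (P.sym (ℕP.^-distribˡ-+-* g (j * d) (j′ * d + t)))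
                                  (P.cong (g ^_) (add-exponent j j′ d t)))))

    ζ^-prod : ∀ n a (b : Fin n → ℕ) → ζ^ a *R prodL (allFin n) (ζ^ ∘ b) ≈ ζ^ (a + ℕΣ.sumL (allFin n) b)
    ζ^-prod zero    a b = trans (*-identityʳ _) (reflexive (P.cong ζ^ (P.sym (ℕP.+-identityʳ a))))
    ζ^-prod (suc n) a b = begin
      ζ^ a *R prodL (allFin (suc n)) (ζ^ ∘ b)
        ≡⟨ P.cong (ζ^ a *R_) (prodL-allFin-suc n (ζ^ ∘ b)) ⟩
      ζ^ a *R (ζ^ (b fzero) *R prodL (allFin n) (ζ^ ∘ b ∘ fsuc))
        ≈⟨ sym (*-assoc _ _ _) ⟩
      (ζ^ a *R ζ^ (b fzero)) *R prodL (allFin n) (ζ^ ∘ b ∘ fsuc)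
        ≈⟨ *-congʳ (sym (ζ^-+ a (b fzero))) ⟩
      ζ^ (a + b fzero) *R prodL (allFin n) (ζ^ ∘ b ∘ fsuc)
        ≈⟨ ζ^-prod n (a + b fzero) (b ∘ fsuc) ⟩
      ζ^ (a + b fzero + ℕΣ.sumL (allFin n) (b ∘ fsuc))
        ≡⟨ P.cong ζ^ (P.trans (ℕP.+-assoc a (b fzero) _) (P.cong (a +_) (P.sym (ℕΣ.sumL-allFin-suc n b)))) ⟩
      ζ^ (a + ℕΣ.sumL (allFin (suc n)) b) ∎

    etaS-expansion : ∀ n (s : Fin (suc n) → ℕ) →
      etaS R p g d m (suc n) ζ s ≈ sumL (tuples n m) (λ J → orbitSum (theta p g d m n s J))
    etaS-expansion n s = begin
      etaS R p g d m (suc n) ζ s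
        ≡⟨ prodL-allFin-suc n (η ∘ s) ⟩
      η (s fzero) *R rest
        ≈⟨ *-congʳ (η-shifted (s fzero) 0) ⟩
      sumR m (λ c → ζ^ (g ^ (c * d + s fzero))) *R rest
        ≈⟨ sumR-*ʳ m rest _ ⟩
      sumR m (λ c → ζ^ (g ^ (c * d + s fzero)) *R rest)
        ≈⟨ sumR-cong m term ⟩
      sumR m (λ c → sumL T (λ J → ζ^ (g ^ (c * d) * θ J)))
        ≡⟨ P.sym (sumL-upTo m _) ⟩
      sumL (upTo m) (λ c → sumL T (λ J → ζ^ (g ^ (c * d) * θ J)))
        ≈⟨ sumL-swap (upTo m) T (λ c J → ζ^ (g ^ (c * d) * θ J)) ⟩
      sumL T (λ J → sumL (upTo m) (λ c → ζ^ (g ^ (c * d) * θ J)))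
        ≈⟨ sumL-cong T (λ J → reflexive (sumL-upTo m _)) ⟩
      sumL T (λ J → orbitSum (θ J)) ∎
      where
      T : List (Vec (Fin m) n)
      T = tuples n m
      θ : Vec (Fin m) n → ℕ
      θ J = theta p g d m n s J
      rest : Carrier
      rest = prodL (allFin n) (λ i → η (s (fsuc i)))
      term : ∀ c → ζ^ (g ^ (c * d + s fzero)) *R rest ≈ sumL T (λ J → ζ^ (g ^ (c * d) * θ J))
      term c = begin
        a *R rest
          ≈⟨ *-congˡ (prodL-cong (allFin n) (λ i → η-shifted (s (fsuc i)) c)) ⟩
        a *R prodL (allFin n) (λ i → sumR m (λ j → ζ^ (g ^ ((c + j) * d + s (fsuc i)))))
          ≈⟨ *-congˡ (prod-of-sums n m (λ i j → ζ^ (g ^ ((c + j) * d + s (fsuc i))))) ⟩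
        a *R sumL T (λ J → prodL (allFin n) (ζ^ ∘ e J))
          ≈⟨ sumL-*ˡ T a _ ⟩
        sumL T (λ J → a *R prodL (allFin n) (ζ^ ∘ e J))
          ≈⟨ sumL-cong T (λ J → ζ^-prod n (g ^ (c * d + s fzero)) (e J)) ⟩
        sumL T (λ J → ζ^ (g ^ (c * d + s fzero) + ℕΣ.sumL (allFin n) (e J)))
          ≈⟨ sumL-cong T (λ J → ζ^-cong (g ^ (c * d + s fzero) + ℕΣ.sumL (allFin n) (e J)) (g ^ (c * d) * θ J) (reduce J)) ⟩
        sumL T (λ J → ζ^ (g ^ (c * d) * θ J)) ∎
        where
        a : Carrier
        a = ζ^ (g ^ (c * d + s fzero))
        e : Vec (Fin m) n → Fin n → ℕ
        e J i = g ^ ((c + toℕ (lookup J i)) * d + s (fsuc i))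
        reduce : ∀ J → (g ^ (c * d + s fzero) + ℕΣ.sumL (allFin n) (e J)) % p ≡ (g ^ (c * d) * θ J) % p
        reduce J = P.trans (P.cong (_% p) (factor-g^ g d c (s fzero) n (λ i → toℕ (lookup J i)) (s ∘ fsuc)))
                           ([m*n]%d≡[m*[n%d]]%d (g ^ (c * d)) _ p)

    period-identity : ∀ n (s : Fin (suc n) → ℕ) →
      etaS R p g d m (suc n) ζ s ≈ nat R (m * zS p g d m (suc n) s) +R sumMuEta R p g d m (suc n) ζ s
    period-identity n s = begin
      etaS R p g d m (suc n) ζ s
        ≈⟨ etaS-expansion n s ⟩
      sumL (tuples n m) (λ J → orbitSum (theta p g d m n s J))
        ≈⟨ ByClass.sum-by-classes (nat R) refl (λ _ → refl) orbitSum (nat R m) η orbitSum-0 (λ _ → orbitSum-class)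
             (theta p g d m n s) (theta<p n s) (tuples n m) ⟩
      nat R m *R nat R (zS p g d m (suc n) s) +R sumR d (λ t → nat R (muS p g d m (suc n) s t) *R η t)
        ≈⟨ +-cong (sym (nat-* m _)) (reflexive (P.sym (sumL-upTo d _))) ⟩
      nat R (m * zS p g d m (suc n) s) +R sumMuEta R p g d m (suc n) ζ s ∎
      where module ByClass = PartitionSums commutativeSemiring p d class 0∉class class-unique class-exists

open import Defs
open import Level using (Level)
open import Data.Nat using (ℕ; zero; suc; _+_; _*_; _∸_; _^_; _<_; _≤_; NonZero; nonTrivial⇒n>1)
open import Data.Fin using (Fin; _<_)
open import Data.Product using (_×_; _,_)
open import Relation.Binary.PropositionalEquality using (_≡_)
open import Algebra.Bundles using (CommutativeRing)
open import Data.Nat.Primality using (prime⇒nonTrivial)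
open import Relation.Nullary.Negation using (contradiction)
open Cyclotomic using (module CyclotomicClasses)
open Periods using (module GaussPeriods)

proposition3 : ∀ {c ℓ : Level} (R : CommutativeRing c ℓ) (ζ : CommutativeRing.Carrier R)
    (p : ℕ) .{{_ : NonZero p}} (g d m k : ℕ) (s : Fin k → ℕ) →
    OddPrime p → IsPrimitiveRoot p g → IsPrimitiveRootOfUnity R p ζ →
    1 ≤ d → d * m ≡ p ∸ 1 → 1 ≤ k → k ≤ d →
    (∀ i j → i Data.Fin.< j → s i Data.Nat.< s j) → (∀ i → s i Data.Nat.< d) →
    CommutativeRing._≈_ R (etaS R p g d m k ζ s)
      (CommutativeRing._+_ R (nat R (m * zS p g d m k s)) (sumMuEta R p g d m k ζ s))
    × (zS p g d m k s + sumℕ d (muS p g d m k s) ≡ m ^ (k ∸ 1))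
proposition3 R ζ zero g d m k s (p-prime , _) _ _ _ _ _ _ _ _ =
  contradiction (nonTrivial⇒n>1 0 {{prime⇒nonTrivial p-prime}}) λ ()
proposition3 R ζ (suc q) g d m zero s _ _ _ _ _ () _ _ _
proposition3 R ζ (suc q) g d m (suc n) s (p-prime , _) (g≢0 , order) (ζ^p≈1 , _) d≥1 d*m≡q _ _ _ _ =
  Gauss.period-identity n s , Classes.class-counts n s
  where
  module Classes = CyclotomicClasses q g d m p-prime g≢0 order d≥1 d*m≡q
  module Gauss = GaussPeriods R ζ q g d m p-prime g≢0 order d≥1 d*m≡q ζ^p≈1
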